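{- Let $R(n)$ be the number of reducible profiles of size at most $n$ and $T(n)$ the number of profiles of size at most $n$. Then $\lim_{n\to\infty} R(n)/T(n) = 0$.
   Context: A profile is a sequence $\mathbf{p}=(p_i)_{i\in\mathbb{N}}$ of natural numbers for which there exists $h\ge -1$ with $p_i\ge 1$ for $0\le i\le h$ and $p_i=0$ for $i>h$ (the null sequence $(0)$ is a profile). $\mathbf{P}$ is the set of profiles, with elementwise sum and product $(\mathbf{p}\times\mathbf{q})_i = p_i\sum_{j=0}^i q_j + q_i\sum_{j=0}^i p_j - p_i q_i$. The size of $\mathbf{p}$ is $|\mathbf{p}|=\sum_{i} p_i$. The profile $(1)=(1,0,0,\ldots)$ is the multiplicative identity. A profile $\mathbf{p}$ is reducible if $\mathbf{p}=\mathbf{q}\times\mathbf{r}$ for some profiles $\mathbf{q},\mathbf{r}$ both different from $(1)$, and irreducible otherwise. -}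

module Defs where

open import Data.Nat using (ℕ; zero; suc; _+_; _*_; _∸_; _≤_)
open import Data.List using (List; []; _∷_; length)
open import Data.Nat.ListAction using (sum)
open import Data.List.Relation.Unary.All using (All)
open import Data.List.Relation.Unary.Unique.Propositional using (Unique)
open import Data.Product using (Σ; _×_; ∃-syntax)
open import Relation.Binary.PropositionalEquality using (_≡_; _≢_)

-- A profile p = (p_0, ..., p_h, 0, 0, ...) is represented by the finite list
-- [p_0, ..., p_h] of its nonzero prefix; the list must consist of entries ≥ 1.
-- The null profile (0) is the empty list.
IsProfile : List ℕ → Set
IsProfile p = All (λ x → 1 ≤ x) p

at : List ℕ → ℕ → ℕ
at []       _       = 0
at (x ∷ _)  zero    = x
at (_ ∷ xs) (suc i) = at xs i

psum : List ℕ → ℕ → ℕ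
psum []       _       = 0
psum (x ∷ _)  zero    = x
psum (x ∷ xs) (suc i) = x + psum xs i

mulAt : List ℕ → List ℕ → ℕ → ℕ
mulAt p q i = (at p i * psum q i + at q i * psum p i) ∸ (at p i * at q i)

size : List ℕ → ℕ
size p = sum p

one : List ℕ
one = 1 ∷ []

Reducible : List ℕ → Set
Reducible p = ∃[ q ] ∃[ r ]
  (IsProfile q × IsProfile r × q ≢ one × r ≢ one × (∀ i → at p i ≡ mulAt q r i))

-- "R(n)/T(n) → 0", with R(n), T(n) given as cardinalities of finite sets:
-- R(n) is the number of reducible profiles of size ≤ n, i.e. the maximal length of a
-- duplicate-free list of such profiles; T(n) is the number of profiles of size ≤ n.
-- The limit statement says: for every k, eventually (k+1)·R(n) ≤ T(n).
-- Equivalently: for every duplicate-free list L of reducible profiles of size ≤ n,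
-- there is a duplicate-free list M of profiles of size ≤ n with (k+1)·|L| ≤ |M|.
RedList : ℕ → List (List ℕ) → Set
RedList n L = Unique L × All (λ p → IsProfile p × size p ≤ n × Reducible p) L

ProfList : ℕ → List (List ℕ) → Set
ProfList n M = Unique M × All (λ p → IsProfile p × size p ≤ n) M

-- In a product q × r of profiles different from (1), every entry after the first is 0 or at
-- least 2, because then Σ_{j≤i} q_j ≥ 2 and Σ_{j≤i} r_j ≥ 2 for i ≥ 1. Raising the first entry
-- by one therefore embeds the reducible profiles of size ≤ n into the compositions of size
-- ≤ n + 1 with all parts ≥ 2, whose number grows like the Fibonacci numbers, i.e. at most by a
-- factor 3 every two steps. The compositions of n, all of which are profiles, number 2ⁿ⁻¹,
-- which grows by a factor 4 every two steps.
module Submission where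

open import Defs
open import Data.Nat using (ℕ; zero; suc; _+_; _*_; _∸_; _^_; _≤_; z≤n; s≤s; NonZero)
open import Data.Nat.Properties
open import Data.Nat.Tactic.RingSolver using (solve-∀)
open import Data.List using (List; []; _∷_; [_]; length; map; _++_)
open import Data.List.Properties using (length-++; length-map; length-removeAt′)
open import Data.List.Membership.Propositional using (_∈_; _─_)
open import Data.List.Membership.Propositional.Properties using (∈-map⁺; ∈-map⁻; ∈-++⁺ˡ; ∈-++⁺ʳ)
open import Data.List.Relation.Binary.Subset.Propositional using (_⊆_)
open import Data.List.Relation.Unary.All as All using (All; []; _∷_)
import Data.List.Relation.Unary.All.Properties as All
open import Data.List.Relation.Unary.Any using (here; there; index)
open import Data.List.Relation.Unary.AllPairs using ([]; _∷_)
open import Data.List.Relation.Unary.Unique.Propositional using (Unique)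
import Data.List.Relation.Unary.Unique.Propositional.Properties as Unique
open import Data.Product using (_×_; _,_; ∃-syntax)
open import Data.Empty using (⊥; ⊥-elim)
open import Relation.Binary.PropositionalEquality
  using (_≡_; _≢_; refl; sym; trans; cong; cong₂; subst; module ≡-Reasoning)

module _ {A : Set} where

  ∈-─⁺ : ∀ {x y : A} {ys : List A} (x∈ys : x ∈ ys) → x ≢ y → y ∈ ys → y ∈ ys ─ x∈ys
  ∈-─⁺ (here refl) x≢y (here refl)  = ⊥-elim (x≢y refl)
  ∈-─⁺ (here refl) x≢y (there y∈ys) = y∈ys
  ∈-─⁺ (there x∈ys) x≢y (here y≡z)  = here y≡z
  ∈-─⁺ (there x∈ys) x≢y (there y∈ys) = there (∈-─⁺ x∈ys x≢y y∈ys)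

  Unique-⊆⇒length≤ : ∀ {xs ys : List A} → Unique xs → xs ⊆ ys → length xs ≤ length ys
  Unique-⊆⇒length≤ {[]}     _              _     = z≤n
  Unique-⊆⇒length≤ {x ∷ xs} {ys} (x∉xs ∷ xs!) x∷xs⊆ys = begin
    suc (length xs)          ≤⟨ s≤s (Unique-⊆⇒length≤ xs! xs⊆ys─x) ⟩
    suc (length (ys ─ x∈ys)) ≡⟨ sym (length-removeAt′ ys (index x∈ys)) ⟩
    length ys                ∎
    where
    open ≤-Reasoning
    x∈ys = x∷xs⊆ys (here refl)
    xs⊆ys─x : xs ⊆ ys ─ x∈ys
    xs⊆ys─x y∈xs = ∈-─⁺ x∈ys (All.lookup x∉xs y∈xs) (x∷xs⊆ys (there y∈xs))

at≤psum : ∀ q i → at q i ≤ psum q i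
at≤psum []      i       = z≤n
at≤psum (x ∷ q) zero    = ≤-refl
at≤psum (x ∷ q) (suc i) = ≤-trans (at≤psum q i) (m≤n+m (psum q i) x)

psum-suc-≥2 : ∀ {r} → IsProfile r → r ≢ one → r ≢ [] → ∀ i → 2 ≤ psum r (suc i)
psum-suc-≥2 {[]}                _               _   r≢[] i = ⊥-elim (r≢[] refl)
psum-suc-≥2 {suc zero ∷ []}     _               r≢1 _    i = ⊥-elim (r≢1 refl)
psum-suc-≥2 {suc (suc x) ∷ []}  _               _   _    i = s≤s (s≤s z≤n)
psum-suc-≥2 {x ∷ y ∷ ys}        (1≤x ∷ 1≤y ∷ _) _   _    i =
  +-mono-≤ 1≤x (≤-trans 1≤y (head≤psum i))
  where
  head≤psum : ∀ i → y ≤ psum (y ∷ ys) i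
  head≤psum zero    = ≤-refl
  head≤psum (suc i) = m≤m+n y _

∸-cross-≥ : ∀ a b A B → a ≤ A → a * B ≤ (a * B + b * A) ∸ a * b
∸-cross-≥ a b A B a≤A = begin
  a * B                   ≤⟨ m≤m+n (a * B) (b * A ∸ a * b) ⟩
  a * B + (b * A ∸ a * b) ≡⟨ sym (+-∸-assoc (a * B) ab≤bA) ⟩
  (a * B + b * A) ∸ a * b ∎
  where
  open ≤-Reasoning
  ab≤bA : a * b ≤ b * A
  ab≤bA = subst (_≤ b * A) (*-comm b a) (*-monoʳ-≤ b a≤A)

∸-cross-≢1 : ∀ a b A B → a ≤ A → 2 ≤ A → 2 ≤ B →
             1 ≤ (a * B + b * A) ∸ a * b → 2 ≤ (a * B + b * A) ∸ a * b
∸-cross-≢1 zero    zero    A B _   _   _   ()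
∸-cross-≢1 zero    (suc b) A B _   2≤A _   _ = ≤-trans 2≤A (m≤m+n A (b * A))
∸-cross-≢1 (suc a) b       A B a≤A _   2≤B _ =
  ≤-trans 2≤B (≤-trans (m≤m+n B (a * B)) (∸-cross-≥ (suc a) b A B a≤A))

mulAt-[]ˡ : ∀ r i → mulAt [] r i ≡ 0
mulAt-[]ˡ r i = *-zeroʳ (at r i)

mulAt-comm : ∀ q r i → mulAt q r i ≡ mulAt r q i
mulAt-comm q r i = cong₂ _∸_ (+-comm (at q i * psum r i) _) (*-comm (at q i) (at r i))

mulAt-suc-≢1 : ∀ {q r} → IsProfile q → IsProfile r → q ≢ one → r ≢ one → ∀ i →
               1 ≤ mulAt q r (suc i) → 2 ≤ mulAt q r (suc i)
mulAt-suc-≢1 {[]} {r} _ _ _ _ i 1≤qr =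
  ⊥-elim (1+n≰n (subst (1 ≤_) (mulAt-[]ˡ r (suc i)) 1≤qr))
mulAt-suc-≢1 {q@(_ ∷ _)} {[]} _ _ _ _ i 1≤qr =
  ⊥-elim (1+n≰n (subst (1 ≤_) (trans (mulAt-comm q [] (suc i)) (mulAt-[]ˡ q (suc i))) 1≤qr))
mulAt-suc-≢1 {q@(_ ∷ _)} {r@(_ ∷ _)} q-prof r-prof q≢1 r≢1 i =
  ∸-cross-≢1 (at q (suc i)) (at r (suc i)) (psum q (suc i)) (psum r (suc i))
    (at≤psum q (suc i))
    (psum-suc-≥2 q-prof q≢1 (λ ()) i) (psum-suc-≥2 r-prof r≢1 (λ ()) i)

incHead : List ℕ → List ℕ
incHead []       = []
incHead (x ∷ xs) = suc x ∷ xs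

incHead-injective : ∀ {xs ys} → incHead xs ≡ incHead ys → xs ≡ ys
incHead-injective {[]}     {[]}     _    = refl
incHead-injective {_ ∷ _}  {_ ∷ _}  refl = refl

All-at : ∀ {P : ℕ → Set} xs → (∀ i → P (at xs i)) → All P xs
All-at []       _ = []
All-at (x ∷ xs) f = f zero ∷ All-at xs (λ i → f (suc i))

reducible⇒incHead-≥2 : ∀ {p} → IsProfile p → Reducible p → All (2 ≤_) (incHead p)
reducible⇒incHead-≥2 {[]}     _              _ = []
reducible⇒incHead-≥2 {x ∷ xs} (1≤x ∷ xs-prof) (q , r , q-prof , r-prof , q≢1 , r≢1 , p≡qr) =
  s≤s 1≤x ∷ All.zipWith apply (xs-prof , All-at xs tail-≢1)
  where
  apply : ∀ {y} → 1 ≤ y × (1 ≤ y → 2 ≤ y) → 2 ≤ y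
  apply (1≤y , 1≤y⇒2≤y) = 1≤y⇒2≤y 1≤y
  tail-≢1 : ∀ i → 1 ≤ at xs i → 2 ≤ at xs i
  tail-≢1 i 1≤xᵢ = subst (2 ≤_) (sym (p≡qr (suc i)))
    (mulAt-suc-≢1 q-prof r-prof q≢1 r≢1 i (subst (1 ≤_) (p≡qr (suc i)) 1≤xᵢ))

parts≥2 : ℕ → List (List ℕ)
parts≥2 zero          = [ [] ]
parts≥2 (suc zero)    = [ [] ]
parts≥2 (suc (suc m)) = [] ∷ (map incHead (parts≥2 (suc m)) ++ map (2 ∷_) (parts≥2 m))

parts≥2-complete : ∀ m {t} → All (2 ≤_) t → size t ≤ m → t ∈ parts≥2 m
parts≥2-complete zero          {[]} _ _ = here refl
parts≥2-complete (suc zero)    {[]} _ _ = here refl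
parts≥2-complete (suc (suc m)) {[]} _ _ = here refl
parts≥2-complete m {zero ∷ _}     (() ∷ _) _
parts≥2-complete m {suc zero ∷ _} (s≤s () ∷ _) _
parts≥2-complete zero       {suc (suc _) ∷ _} _ ()
parts≥2-complete (suc zero) {suc (suc _) ∷ _} _ (s≤s ())
parts≥2-complete (suc (suc m)) {suc (suc zero) ∷ t} (_ ∷ t≥2) (s≤s (s≤s t≤m)) =
  there (∈-++⁺ʳ (map incHead (parts≥2 (suc m))) (∈-map⁺ (2 ∷_) (parts≥2-complete m t≥2 t≤m)))
parts≥2-complete (suc (suc m)) {suc (suc (suc x)) ∷ t} (_ ∷ t≥2) (s≤s x+t≤m) =
  there (∈-++⁺ˡ (∈-map⁺ incHead (parts≥2-complete (suc m) (s≤s (s≤s z≤n) ∷ t≥2) x+t≤m)))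

size-incHead : ∀ p → size (incHead p) ≤ suc (size p)
size-incHead []      = z≤n
size-incHead (_ ∷ _) = ≤-refl

length-reducibles : ∀ {n L} → RedList n L → length L ≤ length (parts≥2 (suc n))
length-reducibles {n} {L} (L! , L-red) = begin
  length L               ≡⟨ sym (length-map incHead L) ⟩
  length (map incHead L) ≤⟨ Unique-⊆⇒length≤ (Unique.map⁺ incHead-injective L!) incHead[L]⊆ ⟩
  length (parts≥2 (suc n)) ∎
  where
  open ≤-Reasoning
  incHead[L]⊆ : map incHead L ⊆ parts≥2 (suc n)
  incHead[L]⊆ mem with p , p∈L , refl ← ∈-map⁻ incHead mem
    with p-prof , p≤n , p-red ← All.lookup L-red p∈L =
    parts≥2-complete (suc n) (reducible⇒incHead-≥2 p-prof p-red)
      (≤-trans (size-incHead p) (s≤s p≤n))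

-- F m = 2 · Fib (m + 1); the extra 1 makes the recurrence of the lengths homogeneous.
F : ℕ → ℕ
F m = suc (length (parts≥2 m))

F-suc-suc : ∀ m → F (suc (suc m)) ≡ F (suc m) + F m
F-suc-suc m = cong suc (begin
  suc (length (map incHead (parts≥2 (suc m)) ++ map (2 ∷_) (parts≥2 m)))
    ≡⟨ cong suc (length-++ (map incHead (parts≥2 (suc m)))) ⟩
  suc (length (map incHead (parts≥2 (suc m))) + length (map (2 ∷_) (parts≥2 m)))
    ≡⟨ cong₂ (λ a b → suc (a + b)) (length-map incHead (parts≥2 (suc m))) (length-map (2 ∷_) (parts≥2 m)) ⟩
  suc (length (parts≥2 (suc m)) + length (parts≥2 m))
    ≡⟨ sym (+-suc _ _) ⟩
  length (parts≥2 (suc m)) + F m ∎)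
  where open ≡-Reasoning

F-mono : ∀ m → F m ≤ F (suc m)
F-mono zero    = ≤-refl
F-mono (suc m) = subst (F (suc m) ≤_) (sym (F-suc-suc m)) (m≤m+n (F (suc m)) (F m))

F-suc≤2F : ∀ m → F (suc m) ≤ 2 * F m
F-suc≤2F zero    = s≤s (s≤s z≤n)
F-suc≤2F (suc m) = begin
  F (suc (suc m))     ≡⟨ F-suc-suc m ⟩
  F (suc m) + F m     ≤⟨ +-monoʳ-≤ (F (suc m)) (F-mono m) ⟩
  F (suc m) + F (suc m) ≡⟨ cong (F (suc m) +_) (sym (+-identityʳ (F (suc m)))) ⟩
  2 * F (suc m)       ∎
  where open ≤-Reasoning

F-suc-suc≤3F : ∀ m → F (suc (suc m)) ≤ 3 * F m
F-suc-suc≤3F m = begin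
  F (suc (suc m))  ≡⟨ F-suc-suc m ⟩
  F (suc m) + F m  ≤⟨ +-monoˡ-≤ (F m) (F-suc≤2F m) ⟩
  2 * F m + F m    ≡⟨ +-comm (2 * F m) (F m) ⟩
  3 * F m          ∎
  where open ≤-Reasoning

F≤2^suc : ∀ m → F m ≤ 2 ^ suc m
F≤2^suc zero    = ≤-refl
F≤2^suc (suc m) = ≤-trans (F-suc≤2F m) (*-monoʳ-≤ 2 (F≤2^suc m))

F-bound : ∀ j d → F (j * 2 + d) ≤ 3 ^ j * 2 ^ suc d
F-bound zero    d = subst (F d ≤_) (sym (+-identityʳ (2 ^ suc d))) (F≤2^suc d)
F-bound (suc j) d = begin
  F (suc (suc (j * 2 + d)))  ≤⟨ F-suc-suc≤3F (j * 2 + d) ⟩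
  3 * F (j * 2 + d)          ≤⟨ *-monoʳ-≤ 3 (F-bound j d) ⟩
  3 * (3 ^ j * 2 ^ suc d)    ≡⟨ sym (*-assoc 3 (3 ^ j) _) ⟩
  3 ^ suc j * 2 ^ suc d      ∎
  where open ≤-Reasoning

compositions : ℕ → List (List ℕ)
compositions zero    = [ one ]
compositions (suc m) = map incHead (compositions m) ++ map (1 ∷_) (compositions m)

compositions-profiles : ∀ m → All (λ p → IsProfile p × size p ≡ suc m) (compositions m)
compositions-profiles zero    = (s≤s z≤n ∷ [] , refl) ∷ []
compositions-profiles (suc m) =
  All.++⁺ (All.map⁺ (All.map incHead-profile ih)) (All.map⁺ (All.map cons-profile ih))
  where
  ih = compositions-profiles m
  incHead-profile : ∀ {p} → IsProfile p × size p ≡ suc m →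
                    IsProfile (incHead p) × size (incHead p) ≡ suc (suc m)
  incHead-profile {_ ∷ _} (_ ∷ ps , eq) = s≤s z≤n ∷ ps , cong suc eq
  cons-profile : ∀ {p} → IsProfile p × size p ≡ suc m →
                 IsProfile (1 ∷ p) × size (1 ∷ p) ≡ suc (suc m)
  cons-profile (ps , eq) = s≤s z≤n ∷ ps , cong suc eq

compositions-unique : ∀ m → Unique (compositions m)
compositions-unique zero    = [] ∷ []
compositions-unique (suc m) =
  Unique.++⁺ (Unique.map⁺ incHead-injective ih) (Unique.map⁺ (λ { refl → refl }) ih) disjoint
  where
  ih = compositions-unique m
  disjoint : ∀ {v} → v ∈ map incHead (compositions m) × v ∈ map (1 ∷_) (compositions m) → ⊥
  disjoint (v∈₁ , v∈₂) with ∈-map⁻ incHead v∈₁ | ∈-map⁻ (1 ∷_) v∈₂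
  ... | p , p∈ , refl | _ , _ , eq with All.lookup (compositions-profiles m) p∈
  ... | (s≤s _ ∷ _) , _ with () ← eq

length-compositions : ∀ m → length (compositions m) ≡ 2 ^ m
length-compositions zero    = refl
length-compositions (suc m) = begin
  length (map incHead (compositions m) ++ map (1 ∷_) (compositions m))
    ≡⟨ length-++ (map incHead (compositions m)) ⟩
  length (map incHead (compositions m)) + length (map (1 ∷_) (compositions m))
    ≡⟨ cong₂ _+_ (trans (length-map incHead (compositions m)) (length-compositions m))
                 (trans (length-map (1 ∷_) (compositions m)) (length-compositions m)) ⟩
  2 ^ m + 2 ^ m
    ≡⟨ cong (2 ^ m +_) (sym (+-identityʳ (2 ^ m))) ⟩
  2 ^ suc m ∎
  where open ≡-Reasoning

bernoulli : ∀ b s → b ^ s * (b + s) ≤ b * suc b ^ s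
bernoulli b zero    = ≤-reflexive (trans (+-identityʳ (b + 0)) (trans (+-identityʳ b) (sym (*-identityʳ b))))
bernoulli b (suc s) = begin
  b * b ^ s * (b + suc s)              ≤⟨ m≤m+n _ (b ^ s * s) ⟩
  b * b ^ s * (b + suc s) + b ^ s * s  ≡⟨ expand b (b ^ s) s ⟩
  suc b * (b ^ s * (b + s))            ≤⟨ *-monoʳ-≤ (suc b) (bernoulli b s) ⟩
  suc b * (b * suc b ^ s)              ≡⟨ *-comm (suc b) _ ⟩
  b * suc b ^ s * suc b                ≡⟨ *-assoc b _ (suc b) ⟩
  b * (suc b ^ s * suc b)              ≡⟨ cong (b *_) (*-comm (suc b ^ s) (suc b)) ⟩
  b * suc b ^ suc s                    ∎
  where
  open ≤-Reasoning
  expand : ∀ b X s → b * X * (b + suc s) + X * s ≡ suc b * (X * (b + s))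
  expand = solve-∀

c*b^bc≤[1+b]^bc : ∀ b c .{{_ : NonZero b}} → c * b ^ (b * c) ≤ suc b ^ (b * c)
c*b^bc≤[1+b]^bc b c = *-cancelˡ-≤ b (begin
  b * (c * b ^ (b * c))      ≡⟨ rearrange b c (b ^ (b * c)) ⟩
  b ^ (b * c) * (b * c)      ≤⟨ *-monoʳ-≤ (b ^ (b * c)) (m≤n+m (b * c) b) ⟩
  b ^ (b * c) * (b + b * c)  ≤⟨ bernoulli b (b * c) ⟩
  b * suc b ^ (b * c)        ∎)
  where
  open ≤-Reasoning
  rearrange : ∀ b c X → b * (c * X) ≡ X * (b * c)
  rearrange = solve-∀

2^[j*2+d] : ∀ j d → 2 ^ (j * 2 + d) ≡ 4 ^ j * 2 ^ d
2^[j*2+d] j d = begin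
  2 ^ (j * 2 + d)     ≡⟨ ^-distribˡ-+-* 2 (j * 2) d ⟩
  2 ^ (j * 2) * 2 ^ d ≡⟨ cong (λ e → 2 ^ e * 2 ^ d) (*-comm j 2) ⟩
  2 ^ (2 * j) * 2 ^ d ≡⟨ cong (_* 2 ^ d) (sym (^-*-assoc 2 2 j)) ⟩
  4 ^ j * 2 ^ d       ∎
  where open ≡-Reasoning

theorem5 : (k : ℕ) → ∃[ N ] ((n : ℕ) → N ≤ n → (L : List (List ℕ)) → RedList n L →
    ∃[ M ] (ProfList n M × suc k * length L ≤ length M))
theorem5 k = suc (j * 2) , eventually
  where
  c = 6 * suc k
  j = 3 * c
  count : ∀ m → j * 2 ≤ m → ∀ {L} → RedList (suc m) L → suc k * length L ≤ length (compositions m)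
  count m j*2≤m {L} L-red with d , refl ← m≤n⇒∃[o]m+o≡n j*2≤m = begin
    suc k * length L                         ≤⟨ *-monoʳ-≤ (suc k) (≤-trans (length-reducibles L-red) (n≤1+n _)) ⟩
    suc k * F (suc j * 2 + d)                ≤⟨ *-monoʳ-≤ (suc k) (F-bound (suc j) d) ⟩
    suc k * (3 * 3 ^ j * (2 * 2 ^ d))        ≡⟨ regroup (suc k) (3 ^ j) (2 ^ d) ⟩
    c * 3 ^ j * 2 ^ d                        ≤⟨ *-monoˡ-≤ (2 ^ d) (c*b^bc≤[1+b]^bc 3 c) ⟩
    4 ^ j * 2 ^ d                            ≡⟨ sym (2^[j*2+d] j d) ⟩
    2 ^ (j * 2 + d)                          ≡⟨ sym (length-compositions (j * 2 + d)) ⟩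
    length (compositions (j * 2 + d))        ∎
    where
    open ≤-Reasoning
    regroup : ∀ K X Y → K * (3 * X * (2 * Y)) ≡ 6 * K * X * Y
    regroup = solve-∀
  profiles : ∀ {n} → All (λ p → IsProfile p × size p ≤ suc n) (compositions n)
  profiles {n} = All.map (λ (p-prof , p≡) → p-prof , ≤-reflexive p≡) (compositions-profiles n)
  eventually : (n : ℕ) → suc (j * 2) ≤ n → (L : List (List ℕ)) → RedList n L →
               ∃[ M ] (ProfList n M × suc k * length L ≤ length M)
  eventually (suc m) (s≤s j*2≤m) L L-red =
    compositions m , (compositions-unique m , profiles) , count m j*2≤m L-red
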